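{- Let $U$ be a countably infinite set and $\mathrm{G}$ a subgroup of $\mathfrak{S}(U)$. The following are equivalent: (i) $\overline{\mathrm{G}}[U]=\{U\}$; (ii) $\overline{\mathrm{G}}\subseteq\mathfrak{S}(U)$; (iii) $\overline{\mathrm{G}\langle F\rangle}\subseteq\mathfrak{S}(U)$ for every finite $F\subseteq U$; (iv) $\overline{\mathrm{G}\langle F\rangle}\subseteq\mathfrak{S}(U)$ for some finite $F\subseteq U$.
   Context: For $X\subseteq U^U$, $\overline{X}$ is the closure of $X$ in $U^U$ for the function topology (maps $f:U\to U$ such that every finite restriction of $f$ is a restriction of some element of $X$). $\overline{\mathrm{G}}[U]=\{f[U]\mid f\in\overline{\mathrm{G}}\}$. For $F\subseteq U$, $\mathrm{G}\langle F\rangle=\{g\in\mathrm{G}\mid g(x)=x\ \forall x\in F\}$. -}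

module Defs where

open import Level using (0ℓ)
open import Data.Nat using (ℕ)
open import Data.Product using (Σ; ∃; _×_; _,_)
open import Data.List using (List; [])
open import Data.List.Membership.Propositional using (_∈_)
open import Relation.Binary.PropositionalEquality using (_≡_)
open import Function.Bundles using (_↔_; _⇔_)

Pred : Set → Set₁
Pred U = (U → U) → Set

Injective : {U : Set} → (U → U) → Set
Injective f = ∀ x y → f x ≡ f y → x ≡ y

Surjective : {U : Set} → (U → U) → Set
Surjective {U} f = ∀ y → Σ U λ x → f x ≡ y

InSym : {U : Set} → (U → U) → Set
InSym f = Injective f × Surjective f

record IsSubgroupOfSym {U : Set} (G : Pred U) : Set where
  field
    bij    : ∀ f → G f → InSym f
    hasId  : G (λ x → x)
    comp   : ∀ f g → G f → G g → G (λ x → f (g x))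
    inv    : ∀ f → G f → Σ (U → U) λ g → G g × (∀ x → g (f x) ≡ x) × (∀ x → f (g x) ≡ x)

-- Closure in the function (pointwise convergence) topology:
-- every finite restriction of f is a restriction of some element of X.
Closure : {U : Set} → Pred U → Pred U
Closure {U} X f = (A : List U) → Σ (U → U) λ g → X g × (∀ x → x ∈ A → g x ≡ f x)

⊆Sym : {U : Set} → Pred U → Set
⊆Sym X = ∀ f → X f → InSym f

Stab : {U : Set} → Pred U → List U → Pred U
Stab G F g = G g × (∀ x → x ∈ F → g x ≡ x)

-- X[U] = {U}: every f ∈ X has image f[U] = U, and X is nonempty
-- (so that the family of images is exactly the singleton {U}).
ImagesAreU : {U : Set} → Pred U → Set
ImagesAreU {U} X = (∀ f → X f → Surjective f) × Σ (U → U) X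

-- If f lies in the closure of G, pick g ∈ G agreeing with f on the finite set F.
-- Then g⁻¹ ∘ f is still in the closure of G and fixes F pointwise, so it lies in
-- the closure of G⟨F⟩; hence if that closure consists of permutations, g⁻¹ ∘ f is
-- onto and so is f. Injectivity of limits of permutations is automatic, since it
-- is witnessed on two-element sets. The remaining implications are monotonicity.
module Submission where

open import Defs
open import Data.Nat using (ℕ)
open import Data.Product using (Σ; _×_; _,_; proj₁; proj₂)
open import Data.List using (List; []; _∷_; _++_)
open import Data.List.Membership.Propositional using (_∈_)
open import Data.List.Membership.Propositional.Properties using (∈-++⁺ˡ; ∈-++⁺ʳ)
open import Data.List.Relation.Unary.Any using (here; there)
open import Function.Bundles using (_↔_; _⇔_; mk⇔)
open import Relation.Binary.PropositionalEquality using (_≡_; refl; sym; trans; cong; module ≡-Reasoning)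

module _ {U : Set} where

  Closure-mono : {X Y : Pred U} → (∀ f → X f → Y f) → ∀ f → Closure X f → Closure Y f
  Closure-mono X⊆Y f cf A with cf A
  ... | g , Xg , g≈f = g , X⊆Y g Xg , g≈f

  Closure-injective : (X : Pred U) → (∀ f → X f → Injective f) → ∀ f → Closure X f → Injective f
  Closure-injective X inj f cf x y fx≡fy with cf (x ∷ y ∷ [])
  ... | g , Xg , g≈f = inj g Xg x y (begin
    g x ≡⟨ g≈f x (here refl) ⟩
    f x ≡⟨ fx≡fy ⟩
    f y ≡⟨ sym (g≈f y (there (here refl))) ⟩
    g y ∎)
    where open ≡-Reasoning

  Closure-Stab : (X : Pred U) (F : List U) → ∀ f → Closure X f →
    (∀ x → x ∈ F → f x ≡ x) → Closure (Stab X F) f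
  Closure-Stab X F f cf fixF A with cf (A ++ F)
  ... | g , Xg , g≈f =
    g , (Xg , λ x x∈F → trans (g≈f x (∈-++⁺ʳ A x∈F)) (fixF x x∈F)) ,
    λ x x∈A → g≈f x (∈-++⁺ˡ x∈A)

  surjective-∘⇒surjective : (h f : U → U) → Injective h →
    Surjective (λ x → h (f x)) → Surjective f
  surjective-∘⇒surjective h f h-inj hf-surj y with hf-surj (h y)
  ... | x , hfx≡hy = x , h-inj (f x) y hfx≡hy

module _ {U : Set} (G : Pred U) (SG : IsSubgroupOfSym G) where
  open IsSubgroupOfSym SG

  Closure-∘ˡ : ∀ h → G h → ∀ f → Closure G f → Closure G (λ x → h (f x))
  Closure-∘ˡ h Gh f cf A with cf A
  ... | g , Gg , g≈f = (λ x → h (g x)) , comp h g Gh Gg , λ x x∈A → cong h (g≈f x x∈A)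

  Closure-injective-Sym : ∀ f → Closure G f → Injective f
  Closure-injective-Sym = Closure-injective G (λ g Gg → proj₁ (bij g Gg))

  ImagesAreU⇔⊆Sym : ImagesAreU (Closure G) ⇔ ⊆Sym (Closure G)
  ImagesAreU⇔⊆Sym = mk⇔
    (λ (surj , _) f cf → Closure-injective-Sym f cf , surj f cf)
    (λ symCl → (λ f cf → proj₂ (symCl f cf)) ,
             (λ x → x) , λ A → (λ x → x) , hasId , λ _ _ → refl)

  ⊆Sym⇒⊆Sym-Stab : ⊆Sym (Closure G) → (F : List U) → ⊆Sym (Closure (Stab G F))
  ⊆Sym⇒⊆Sym-Stab symCl F f cf = symCl f (Closure-mono (λ _ → proj₁) f cf)

  ⊆Sym-Stab⇒⊆Sym : (F : List U) → ⊆Sym (Closure (Stab G F)) → ⊆Sym (Closure G)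
  ⊆Sym-Stab⇒⊆Sym F symF f cf with cf F
  ... | g , Gg , g≈f =
    Closure-injective-Sym f cf ,
    surjective-∘⇒surjective g⁻¹ f (proj₁ (bij g⁻¹ Gg⁻¹)) (proj₂ (symF _ g⁻¹∘f∈cl))
    where
    open ≡-Reasoning
    g⁻¹ : U → U
    g⁻¹ = proj₁ (inv g Gg)
    Gg⁻¹ : G g⁻¹
    Gg⁻¹ = proj₁ (proj₂ (inv g Gg))
    g⁻¹g≡id : ∀ x → g⁻¹ (g x) ≡ x
    g⁻¹g≡id = proj₁ (proj₂ (proj₂ (inv g Gg)))
    g⁻¹∘f-fixes-F : ∀ x → x ∈ F → g⁻¹ (f x) ≡ x
    g⁻¹∘f-fixes-F x x∈F = begin
      g⁻¹ (f x) ≡⟨ cong g⁻¹ (sym (g≈f x x∈F)) ⟩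
      g⁻¹ (g x) ≡⟨ g⁻¹g≡id x ⟩
      x         ∎
    g⁻¹∘f∈cl : Closure (Stab G F) (λ x → g⁻¹ (f x))
    g⁻¹∘f∈cl = Closure-Stab G F _ (Closure-∘ˡ g⁻¹ Gg⁻¹ f cf) g⁻¹∘f-fixes-F

lemma3p8 : (U : Set) → ℕ ↔ U → (G : Pred U) → IsSubgroupOfSym G →
    (ImagesAreU (Closure G) ⇔ ⊆Sym (Closure G))
    × (⊆Sym (Closure G) ⇔ ((F : List U) → ⊆Sym (Closure (Stab G F))))
    × (((F : List U) → ⊆Sym (Closure (Stab G F))) ⇔ Σ (List U) (λ F → ⊆Sym (Closure (Stab G F))))
lemma3p8 U _ G SG =
  ImagesAreU⇔⊆Sym G SG ,
  mk⇔ (⊆Sym⇒⊆Sym-Stab G SG) (λ symF → ⊆Sym-Stab⇒⊆Sym G SG [] (symF [])) ,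
  mk⇔ (λ symF → [] , symF [])
      (λ (F , symF) → ⊆Sym⇒⊆Sym-Stab G SG (⊆Sym-Stab⇒⊆Sym G SG F symF))
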